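{- Let $L\ge1$ and $Q=Q_0Q_1\cdots Q_L$ with $Q_0,\dots,Q_L$ pairwise coprime positive integers. Let $p>3$ be a prime with $p^{\nu}\,\|\,Q_0$, $\nu\ge1$, and let $\mathbf h=(h_1,\dots,h_L)\in\mathbb{Z}^L$. For $I\subseteq\{1,\dots,L\}$ put $H_I=\sum_{i\in I}Q_ih_i$, let $T_{\mathbf h}=\{H_I \bmod p^\nu: I\subseteq\{1,\dots,L\}\}$, and for $\tau\in\mathbb{Z}/p^\nu\mathbb{Z}$ let $\mu_{\mathbf h}(\tau)$ (resp. $\nu_{\mathbf h}(\tau)$) be the number of subsets $I\subseteq\{1,\dots,L\}$ of even (resp. odd) cardinality with $H_I\equiv\tau\pmod{p^\nu}$. If $\mu_{\mathbf h}(\tau)\equiv\nu_{\mathbf h}(\tau)\pmod 3$ for all $\tau\in T_{\mathbf h}$, then there is $1\le i\le L$ with $p\mid h_i$. -}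

module Defs where

open import Data.Nat using (ℕ; zero; suc; _^_; _%_)
import Data.Nat as ℕ
open import Data.Nat.Properties using (_≟_)
open import Data.Integer using (ℤ; +_; _+_; _*_)
import Data.Integer as ℤ
open import Data.Bool using (Bool; true; false; if_then_else_)
open import Data.Fin using (Fin; zero; suc)
open import Data.Vec using (Vec; []; _∷_)
open import Data.List using (List; []; _∷_; map; _++_; length; filter)
open import Data.Fin.Subset using (Subset; ∣_∣)
open import Relation.Nullary using (¬_)
open import Data.Product using (_×_)

allSubsets : (L : ℕ) → List (Subset L)
allSubsets zero = [] ∷ []
allSubsets (suc L) = map (false ∷_) (allSubsets L) ++ map (true ∷_) (allSubsets L)

subsetSum : {L : ℕ} → (Fin L → ℤ) → Subset L → ℤ
subsetSum {zero} c [] = + 0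
subsetSum {suc L} c (b ∷ I) = (if b then c zero else + 0) + subsetSum (λ i → c (suc i)) I

-- H_I for the data Q : Fin (suc L) → ℕ (Q_0..Q_L), h : Fin L → ℤ (h_1..h_L);
-- the index i : Fin L corresponds to i+1, with coefficient Q_{i+1} h_{i+1}
H : {L : ℕ} → (Q : Fin (suc L) → ℕ) → (h : Fin L → ℤ) → Subset L → ℤ
H Q h I = subsetSum (λ i → (+ Q (suc i)) * h i) I

resMod : (m : ℕ) → .{{ℕ.NonZero m}} → ℤ → ℕ
resMod (suc k) x = x ℤ.% (+ suc k)

evenCount : {L : ℕ} → (m : ℕ) → .{{ℕ.NonZero m}} → (Subset L → ℤ) → ℕ → ℕ
evenCount {L} m HI τ =
  length (filter (λ I → ((∣ I ∣ % 2) ≟ 0) Relation.Nullary.×-dec (resMod m (HI I) ≟ τ)) (allSubsets L))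

oddCount : {L : ℕ} → (m : ℕ) → .{{ℕ.NonZero m}} → (Subset L → ℤ) → ℕ → ℕ
oddCount {L} m HI τ =
  length (filter (λ I → ((∣ I ∣ % 2) ≟ 1) Relation.Nullary.×-dec (resMod m (HI I) ≟ τ)) (allSubsets L))

{-# OPTIONS --safe #-}
-- Write c_i = Q_i h_i and m = p^ν. The signed count A_c(t) = μ_h(t) − ν_h(t) is the coefficient of
-- X^t in ∏_i (1 − X^(c_i)) computed in ℤ[X]/(X^m − 1), so splitting off the first factor gives
-- A_c(t) = A_c′(t) − A_c′(t − c_1) with c′ = (c_2, …, c_L). The hypothesis says A_c ≡ 0 (mod 3).
-- If p divides no h_i, every c_i is a unit modulo m, and then A_c is not even constant modulo 3, by
-- induction on L: were A_c ≡ k, then G = A_c′ would satisfy G(t + c_1) ≡ G(t) + k; adding up m such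
-- steps and using that G has period m gives m k ≡ 0, so k ≡ 0 because 3 ∤ m. Then G is invariant under
-- shifts by c_1, hence by u c_1 ≡ 1 for an inverse u of c_1, so G is constant, against the induction
-- hypothesis. For L = 0, A is the indicator of t ≡ 0, which is not constant as m > 1.

module Submission where

open import Defs
open import Data.Bool using (true; false)
open import Data.Fin using (Fin; zero; suc)
open import Data.Fin.Properties using (any?)
open import Data.Fin.Subset using (Subset)
import Data.Fin.Subset as S
open import Data.Integer as ℤ using (ℤ; +_; -[1+_]; 0ℤ; 1ℤ; _+_; _-_; _*_; -_; ∣_∣)
import Data.Integer.DivMod as ℤ
import Data.Integer.Divisibility as ℤD
open import Data.Integer.Divisibility.Signed
  using (divides; ∣ᵤ⇒∣; ∣⇒∣ᵤ; ∣m⇒∣-m; ∣m∣n⇒∣m+n) renaming (_∣_ to _∣ₛ_)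
import Data.Integer.Properties as ℤ
open import Data.Integer.Tactic.RingSolver using (solve)
open import Data.List using ([]; _∷_; map; _++_; length; filter)
open import Data.List.Properties
  using (length-++; filter-++; filter-≐; filter-accept; filter-reject; filter-none)
import Data.List.Relation.Unary.All as All
open import Data.List.Relation.Unary.All.Properties using (¬Any⇒All¬)
import Data.List.Relation.Unary.Any as Any
open import Data.Nat as ℕ using (ℕ; zero; suc; _^_; _<_; _≤_; _%_; NonZero)
open import Data.Nat.Coprimality as Coprime using (Coprime; coprime-divisor; coprime-Bézout; prime⇒coprime)
open import Data.Nat.Divisibility as ℕ using (_∣_)
import Data.Nat.DivMod as ℕ
open import Data.Nat.GCD using (module Bézout)
open import Data.Nat.Primality using (Prime; prime⇒irreducible; euclidsLemma)
open import Data.Nat.Properties as ℕ using (_≟_)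
open import Data.Product using (∃; ∃-syntax; _×_; _,_; proj₂)
open import Data.Product.Function.NonDependent.Propositional using (_×-⇔_)
open import Data.Sum using (inj₁; inj₂; [_,_]; [_,_]′)
import Data.Vec as Vec
open import Function using (_⇔_; mk⇔; _∘_; Equivalence)
open import Function.Construct.Identity using (⇔-id)
open import Relation.Binary.Bundles using (Setoid)
open import Relation.Binary.PropositionalEquality
  using (_≡_; _≢_; refl; sym; trans; cong; cong₂; subst; subst₂; module ≡-Reasoning)
import Relation.Binary.Reasoning.Setoid
open import Relation.Nullary using (¬_; contradiction; does; yes; no; _×-dec_)
open import Relation.Unary using (Pred; Decidable)

-- Congruence of integers

-- A record rather than a synonym for + n ∣ₛ x - y, so that x, y and n can be inferred from a proof.
infix 4 _≡_mod_
record _≡_mod_ (x y : ℤ) (n : ℕ) : Set where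
  constructor ≡-mod
  field ∣-difference : + n ∣ₛ x - y
open _≡_mod_

module _ {n : ℕ} where

  ≡-mod-refl : ∀ {x} → x ≡ x mod n
  ≡-mod-refl {x} = ≡-mod (divides 0ℤ (ℤ.+-inverseʳ x))

  ≡-mod-sym : ∀ {x y} → x ≡ y mod n → y ≡ x mod n
  ≡-mod-sym {x} {y} (≡-mod n∣x-y) = ≡-mod (subst (+ n ∣ₛ_) -[x-y]≡y-x (∣m⇒∣-m n∣x-y))
    where
    -[x-y]≡y-x : - (x - y) ≡ y - x
    -[x-y]≡y-x = solve (x ∷ y ∷ [])

  ≡-mod-trans : ∀ {x y z} → x ≡ y mod n → y ≡ z mod n → x ≡ z mod n
  ≡-mod-trans {x} {y} {z} (≡-mod n∣x-y) (≡-mod n∣y-z) =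
    ≡-mod (subst (+ n ∣ₛ_) (ℤ.+-minus-telescope x y z) (∣m∣n⇒∣m+n n∣x-y n∣y-z))

  ≡-mod-setoid : Setoid _ _
  ≡-mod-setoid = record
    { Carrier = ℤ
    ; _≈_ = λ x y → x ≡ y mod n
    ; isEquivalence = record { refl = ≡-mod-refl ; sym = ≡-mod-sym ; trans = ≡-mod-trans }
    }

  +-cong-mod : ∀ {x x′ y y′} → x ≡ x′ mod n → y ≡ y′ mod n → x + y ≡ x′ + y′ mod n
  +-cong-mod {x} {x′} {y} {y′} (≡-mod n∣x-x′) (≡-mod n∣y-y′) =
    ≡-mod (subst (+ n ∣ₛ_) regroup (∣m∣n⇒∣m+n n∣x-x′ n∣y-y′))
    where
    regroup : (x - x′) + (y - y′) ≡ (x + y) - (x′ + y′)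
    regroup = solve (x ∷ x′ ∷ y ∷ y′ ∷ [])

  +-congˡ-mod : ∀ x {y y′} → y ≡ y′ mod n → x + y ≡ x + y′ mod n
  +-congˡ-mod x = +-cong-mod (≡-mod-refl {x})

  +-congʳ-mod : ∀ y {x x′} → x ≡ x′ mod n → x + y ≡ x′ + y mod n
  +-congʳ-mod y x≡x′ = +-cong-mod x≡x′ (≡-mod-refl {y})

  +-cancelˡ-mod : ∀ x {y z} → x + y ≡ x + z mod n → y ≡ z mod n
  +-cancelˡ-mod x {y} {z} (≡-mod n∣x+y-[x+z]) = ≡-mod (subst (+ n ∣ₛ_) cancel n∣x+y-[x+z])
    where
    cancel : (x + y) - (x + z) ≡ y - z
    cancel = solve (x ∷ y ∷ z ∷ [])

  n*x≡0-mod : ∀ x → + n * x ≡ 0ℤ mod n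
  n*x≡0-mod x = ≡-mod (divides x (trans (ℤ.+-identityʳ (+ n * x)) (ℤ.*-comm (+ n) x)))

  x≡y⇒x-y≡0-mod : ∀ {x y} → x ≡ y mod n → x - y ≡ 0ℤ mod n
  x≡y⇒x-y≡0-mod {x} {y} (≡-mod n∣x-y) =
    ≡-mod (subst (+ n ∣ₛ_) (sym (ℤ.+-identityʳ (x - y))) n∣x-y)

module ≡-mod-Reasoning (n : ℕ) = Relation.Binary.Reasoning.Setoid (≡-mod-setoid {n})

*-cancelˡ-mod : ∀ {d} m {x y} → Coprime d m → + m * x ≡ + m * y mod d → x ≡ y mod d
*-cancelˡ-mod {d} m {x} {y} d⊥m (≡-mod d∣mx-my) =
  ≡-mod (∣ᵤ⇒∣ (coprime-divisor d⊥m (subst (d ∣_) ∣mx-my∣≡m∣x-y∣ (∣⇒∣ᵤ d∣mx-my))))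
  where
  ∣mx-my∣≡m∣x-y∣ : ∣ + m * x - + m * y ∣ ≡ m ℕ.* ∣ x - y ∣
  ∣mx-my∣≡m∣x-y∣ = trans (cong ∣_∣ (distrib (+ m))) (ℤ.abs-* (+ m) (x - y))
    where
    distrib : ∀ M → M * x - M * y ≡ M * (x - y)
    distrib M = solve (M ∷ x ∷ y ∷ [])

-- Residues and units

resMod<m : ∀ m .{{_ : NonZero m}} x → resMod m x < m
resMod<m (suc k) x = ℤ.n%d<d x (+ suc k)

≡-mod-resMod : ∀ m .{{_ : NonZero m}} x → x ≡ + resMod m x mod m
≡-mod-resMod (suc k) x = ≡-mod (divides (x ℤ./ + suc k) (begin
  x - + r                      ≡⟨ cong (_- + r) (ℤ.a≡a%n+[a/n]*n x (+ suc k)) ⟩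
  (+ r + q) - + r              ≡⟨ cancel (+ r) q ⟩
  q                            ∎))
  where
  open ≡-Reasoning
  r = x ℤ.% + suc k
  q = (x ℤ./ + suc k) * + suc k
  cancel : ∀ a b → (a + b) - a ≡ b
  cancel a b = solve (a ∷ b ∷ [])

resMod-pos : ∀ d .{{_ : NonZero d}} n → resMod d (+ n) ≡ n % d
resMod-pos (suc k) n = refl

module _ {m : ℕ} .{{_ : NonZero m}} where

  resMod-unique : ∀ {a b} → a < m → b < m → + a ≡ + b mod m → a ≡ b
  resMod-unique {a} {b} a<m b<m (≡-mod m∣a-b) =
    ℤ.+-injective (ℤ.i-j≡0⇒i≡j (+ a) (+ b) (ℤ.∣i∣≡0⇒i≡0 ∣a-b∣≡0))
    where
    ∣a-b∣<m : ∣ + a - + b ∣ < m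
    ∣a-b∣<m = subst (ℕ._< m) (cong ∣_∣ (sym (ℤ.[+m]-[+n]≡m⊖n a b)))
                (ℕ.≤-<-trans (ℤ.∣m⊝n∣≤m⊔n a b) (ℕ.⊔-pres-<m a<m b<m))
    ∣a-b∣≡0 : ∣ + a - + b ∣ ≡ 0
    ∣a-b∣≡0 = trans (sym (ℕ.m<n⇒m%n≡m ∣a-b∣<m)) (ℕ.n∣m⇒m%n≡0 _ m (∣⇒∣ᵤ m∣a-b))

  ≡-mod⇒resMod≡ : ∀ {x y} → x ≡ y mod m → resMod m x ≡ resMod m y
  ≡-mod⇒resMod≡ {x} {y} x≡y = resMod-unique (resMod<m m x) (resMod<m m y) (begin
    + resMod m x  ≈⟨ ≡-mod-resMod m x ⟨
    x             ≈⟨ x≡y ⟩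
    y             ≈⟨ ≡-mod-resMod m y ⟩
    + resMod m y  ∎)
    where open ≡-mod-Reasoning m

  resMod≡⇒≡-mod : ∀ {x y} → resMod m x ≡ resMod m y → x ≡ y mod m
  resMod≡⇒≡-mod {x} {y} rx≡ry = begin
    x             ≈⟨ ≡-mod-resMod m x ⟩
    + resMod m x  ≡⟨ cong +_ rx≡ry ⟩
    + resMod m y  ≈⟨ ≡-mod-resMod m y ⟨
    y             ∎
    where open ≡-mod-Reasoning m

UnitMod : ℕ → ℤ → Set
UnitMod m a = ∃[ x ] x * a ≡ 1ℤ mod m

coprime⇒unitMod : ∀ {m} a → Coprime ∣ a ∣ m → UnitMod m a
coprime⇒unitMod {m} (+ n) n⊥m = inverse (coprime-Bézout n⊥m)
  where
  ℤ-identity : ∀ a b c d → 1 ℕ.+ a ℕ.* b ≡ c ℕ.* d → 1ℤ + + a * + b ≡ + c * + d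
  ℤ-identity a b c d eq = begin
    1ℤ + + a * + b    ≡⟨ cong (λ z → 1ℤ + z) (ℤ.pos-* a b) ⟨
    + (1 ℕ.+ a ℕ.* b) ≡⟨ cong +_ eq ⟩
    + (c ℕ.* d)       ≡⟨ ℤ.pos-* c d ⟩
    + c * + d         ∎
    where open ≡-Reasoning
  inverse : Bézout.Identity 1 n m → UnitMod m (+ n)
  inverse (Bézout.+- x y eq) =
    + x , ≡-mod (divides (+ y) (shift (+ x) (+ n) (+ y) (+ m) (ℤ-identity y m x n eq)))
    where
    shift : ∀ X N Y M → 1ℤ + Y * M ≡ X * N → X * N - 1ℤ ≡ Y * M
    shift X N Y M e = begin
      X * N - 1ℤ          ≡⟨ cong (_- 1ℤ) e ⟨
      1ℤ + Y * M - 1ℤ     ≡⟨ solve (Y ∷ M ∷ []) ⟩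
      Y * M               ∎
      where open ≡-Reasoning
  inverse (Bézout.-+ x y eq) =
    - + x , ≡-mod (divides (- + y) (shift (+ x) (+ n) (+ y) (+ m) (ℤ-identity x n y m eq)))
    where
    shift : ∀ X N Y M → 1ℤ + X * N ≡ Y * M → (- X) * N - 1ℤ ≡ (- Y) * M
    shift X N Y M e = begin
      (- X) * N - 1ℤ      ≡⟨ solve (X ∷ N ∷ []) ⟩
      - (1ℤ + X * N)      ≡⟨ cong -_ e ⟩
      - (Y * M)           ≡⟨ solve (Y ∷ M ∷ []) ⟩
      (- Y) * M           ∎
      where open ≡-Reasoning
coprime⇒unitMod {m} -[1+ n ] n⊥m with coprime⇒unitMod (+ suc n) n⊥m
... | x , x*n≡1 = - x , subst (_≡ 1ℤ mod m) (negate x (+ suc n)) x*n≡1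
  where
  negate : ∀ X N → X * N ≡ (- X) * (- N)
  negate X N = solve (X ∷ N ∷ [])

coprime-^ : ∀ {a n} k → Coprime a n → Coprime a (n ^ k)
coprime-^ zero    _   (_ , d∣1) = ℕ.∣1⇒≡1 d∣1
coprime-^ {a} {n} (suc k) a⊥n {d} (d∣a , d∣n*nᵏ) =
  coprime-^ k a⊥n (d∣a , coprime-divisor d⊥n d∣n*nᵏ)
  where
  d⊥n : Coprime d n
  d⊥n (e∣d , e∣n) = a⊥n (ℕ.∣-trans e∣d d∣a , e∣n)

∤⇒coprime : ∀ {p a} → Prime p → ¬ p ∣ a → Coprime a p
∤⇒coprime p-prime p∤a {d} (d∣a , d∣p) with prime⇒irreducible p-prime d∣p
... | inj₁ d≡1 = d≡1
... | inj₂ refl = contradiction d∣a p∤a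

-- Shifting a periodic function

module _ {d m : ℕ} (G : ℤ → ℤ) (G-periodic : ∀ {y z} → y ≡ z mod m → G y ≡ G z) where

  open ≡-mod-Reasoning d

  telescope : ∀ {a k} → (∀ t → G (t + a) ≡ G t + k mod d) →
              ∀ n t → G (t + + n * a) ≡ G t + + n * k mod d
  telescope step zero t = begin
    G (t + 0ℤ)   ≡⟨ cong G (ℤ.+-identityʳ t) ⟩
    G t          ≡⟨ ℤ.+-identityʳ (G t) ⟨
    G t + 0ℤ     ∎
  telescope {a} {k} step (suc n) t = begin
    G (t + + suc n * a)        ≡⟨ cong G (peel t (+ n) a) ⟩
    G ((t + + n * a) + a)      ≈⟨ step (t + + n * a) ⟩
    G (t + + n * a) + k        ≈⟨ +-congʳ-mod k (telescope step n t) ⟩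
    (G t + + n * k) + k        ≡⟨ peel (G t) (+ n) k ⟨
    G t + + suc n * k          ∎
    where
    peel : ∀ x N y → x + (1ℤ + N) * y ≡ (x + N * y) + y
    peel x N y = solve (x ∷ N ∷ y ∷ [])

  invariant-multiples : ∀ {a} → (∀ t → G (t + a) ≡ G t mod d) → ∀ x t → G (t + x * a) ≡ G t mod d
  invariant-multiples {a} inv (+ n) t = begin
    G (t + + n * a)     ≈⟨ telescope step n t ⟩
    G t + + n * 0ℤ      ≡⟨ cong (λ z → G t + z) (ℤ.*-zeroʳ (+ n)) ⟩
    G t + 0ℤ            ≡⟨ ℤ.+-identityʳ (G t) ⟩
    G t                 ∎
    where
    step : ∀ t → G (t + a) ≡ G t + 0ℤ mod d
    step t = subst (λ z → G (t + a) ≡ z mod d) (sym (ℤ.+-identityʳ (G t))) (inv t)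
  invariant-multiples {a} inv -[1+ n ] t = begin
    G (t + -[1+ n ] * a)                      ≈⟨ invariant-multiples inv (+ suc n) (t + -[1+ n ] * a) ⟨
    G ((t + -[1+ n ] * a) + + suc n * a)      ≡⟨ cong G (cancel t (+ suc n) a) ⟩
    G t                                       ∎
    where
    cancel : ∀ x N y → (x + (- N) * y) + N * y ≡ x
    cancel x N y = solve (x ∷ N ∷ y ∷ [])

  drift≡0 : ∀ {a k} → Coprime d m → (∀ t → G (t + a) ≡ G t + k mod d) → k ≡ 0ℤ mod d
  drift≡0 {a} {k} d⊥m step = *-cancelˡ-mod m d⊥m (+-cancelˡ-mod (G 0ℤ) (begin
    G 0ℤ + + m * k       ≈⟨ telescope step m 0ℤ ⟨
    G (0ℤ + + m * a)     ≡⟨ G-periodic (≡-mod-sym (multiple-of-m a)) ⟨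
    G 0ℤ                 ≡⟨ ℤ.+-identityʳ (G 0ℤ) ⟨
    G 0ℤ + 0ℤ            ≡⟨ cong (λ z → G 0ℤ + z) (ℤ.*-zeroʳ (+ m)) ⟨
    G 0ℤ + + m * 0ℤ      ∎))
    where
    multiple-of-m : ∀ a → 0ℤ + + m * a ≡ 0ℤ mod m
    multiple-of-m a = subst (_≡ 0ℤ mod m) (sym (ℤ.+-identityˡ (+ m * a))) (n*x≡0-mod a)

  constant-under-unit-drift : ∀ {a k} → Coprime d m → UnitMod m a →
                              (∀ t → G (t + a) ≡ G t + k mod d) → ∀ t → G t ≡ G 0ℤ mod d
  constant-under-unit-drift {a} {k} d⊥m (x , x*a≡1) step t = begin
    G t                 ≡⟨ cong G (solve (t ∷ [])) ⟩
    G (0ℤ + t * 1ℤ)     ≈⟨ invariant-multiples invariant-1 t 0ℤ ⟩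
    G 0ℤ                ∎
    where
    invariant-a : ∀ t → G (t + a) ≡ G t mod d
    invariant-a t = begin
      G (t + a)         ≈⟨ step t ⟩
      G t + k           ≈⟨ +-congˡ-mod (G t) (drift≡0 d⊥m step) ⟩
      G t + 0ℤ          ≡⟨ ℤ.+-identityʳ (G t) ⟩
      G t               ∎
    invariant-1 : ∀ t → G (t + 1ℤ) ≡ G t mod d
    invariant-1 t = begin
      G (t + 1ℤ)        ≡⟨ G-periodic (+-congˡ-mod t x*a≡1) ⟨
      G (t + x * a)     ≈⟨ invariant-multiples invariant-a x t ⟩
      G t               ∎

-- Counting subsets by parity and residue

length-filter-map : ∀ {a b p} {A : Set a} {B : Set b} {P : Pred B p} (P? : Decidable P) (f : A → B) xs →
                    length (filter P? (map f xs)) ≡ length (filter (P? ∘ f) xs)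
length-filter-map P? f [] = refl
length-filter-map P? f (x ∷ xs) with does (P? (f x))
... | true  = cong suc (length-filter-map P? f xs)
... | false = length-filter-map P? f xs

length-filter-⇔ : ∀ {a p q} {A : Set a} {P : Pred A p} {Q : Pred A q} (P? : Decidable P) (Q? : Decidable Q) →
                  (∀ x → P x ⇔ Q x) → ∀ xs → length (filter P? xs) ≡ length (filter Q? xs)
length-filter-⇔ P? Q? P⇔Q xs =
  cong length (filter-≐ P? Q? ((λ {x} → Equivalence.to (P⇔Q x)) , (λ {x} → Equivalence.from (P⇔Q x))) xs)

length-filter-allSubsets : ∀ {L p} {P : Pred (Subset (suc L)) p} (P? : Decidable P) →
  length (filter P? (allSubsets (suc L)))
    ≡ length (filter (P? ∘ (false Vec.∷_)) (allSubsets L)) ℕ.+ length (filter (P? ∘ (true Vec.∷_)) (allSubsets L))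
length-filter-allSubsets {L} P? = begin
  length (filter P? (map (false Vec.∷_) A ++ map (true Vec.∷_) A))
    ≡⟨ cong length (filter-++ P? (map (false Vec.∷_) A) (map (true Vec.∷_) A)) ⟩
  length (filter P? (map (false Vec.∷_) A) ++ filter P? (map (true Vec.∷_) A))
    ≡⟨ length-++ (filter P? (map (false Vec.∷_) A)) ⟩
  length (filter P? (map (false Vec.∷_) A)) ℕ.+ length (filter P? (map (true Vec.∷_) A))
    ≡⟨ cong₂ ℕ._+_ (length-filter-map P? (false Vec.∷_) A) (length-filter-map P? (true Vec.∷_) A) ⟩
  length (filter (P? ∘ (false Vec.∷_)) A) ℕ.+ length (filter (P? ∘ (true Vec.∷_)) A) ∎
  where
  open ≡-Reasoning
  A = allSubsets L

even-suc : ∀ n → suc n % 2 ≡ 0 ⇔ n % 2 ≡ 1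
even-suc zero          = mk⇔ (λ ()) (λ ())
even-suc (suc zero)    = mk⇔ (λ _ → refl) (λ _ → refl)
even-suc (suc (suc n)) = even-suc n

odd-suc : ∀ n → suc n % 2 ≡ 1 ⇔ n % 2 ≡ 0
odd-suc zero          = mk⇔ (λ _ → refl) (λ _ → refl)
odd-suc (suc zero)    = mk⇔ (λ ()) (λ ())
odd-suc (suc (suc n)) = odd-suc n

signedCount : ∀ {L} (m : ℕ) .{{_ : NonZero m}} → (Subset L → ℤ) → ℕ → ℤ
signedCount m HI τ = + evenCount m HI τ - + oddCount m HI τ

module _ {m : ℕ} .{{_ : NonZero m}} where

  parity-hit? : ∀ {L} (k : ℕ) (HI : Subset L → ℤ) (τ : ℕ) →
                Decidable (λ I → (S.∣ I ∣ % 2 ≡ k) × (resMod m (HI I) ≡ τ))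
  parity-hit? k HI τ I = (S.∣ I ∣ % 2 ≟ k) ×-dec (resMod m (HI I) ≟ τ)

  parityCount : ∀ {L} (k : ℕ) (HI : Subset L → ℤ) (τ : ℕ) → ℕ
  parityCount {L} k HI τ = length (filter (parity-hit? k HI τ) (allSubsets L))

  evenCount-∷ : ∀ {L} (HI : Subset (suc L) → ℤ) τ →
    evenCount m HI τ ≡ evenCount m (HI ∘ (false Vec.∷_)) τ ℕ.+ oddCount m (HI ∘ (true Vec.∷_)) τ
  evenCount-∷ {L} HI τ = trans (length-filter-allSubsets (parity-hit? 0 HI τ))
    (cong (evenCount m (HI ∘ (false Vec.∷_)) τ ℕ.+_)
      (length-filter-⇔ (parity-hit? 0 HI τ ∘ (true Vec.∷_)) (parity-hit? 1 (HI ∘ (true Vec.∷_)) τ)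
        (λ I → even-suc S.∣ I ∣ ×-⇔ ⇔-id _) (allSubsets L)))

  oddCount-∷ : ∀ {L} (HI : Subset (suc L) → ℤ) τ →
    oddCount m HI τ ≡ oddCount m (HI ∘ (false Vec.∷_)) τ ℕ.+ evenCount m (HI ∘ (true Vec.∷_)) τ
  oddCount-∷ {L} HI τ = trans (length-filter-allSubsets (parity-hit? 1 HI τ))
    (cong (oddCount m (HI ∘ (false Vec.∷_)) τ ℕ.+_)
      (length-filter-⇔ (parity-hit? 1 HI τ ∘ (true Vec.∷_)) (parity-hit? 0 (HI ∘ (true Vec.∷_)) τ)
        (λ I → odd-suc S.∣ I ∣ ×-⇔ ⇔-id _) (allSubsets L)))

  signedCount-[]-hit : (HI : Subset 0 → ℤ) {τ : ℕ} → resMod m (HI Vec.[]) ≡ τ → signedCount m HI τ ≡ 1ℤ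
  signedCount-[]-hit HI hit =
    cong (λ n → + n - 0ℤ) (cong length (filter-accept (parity-hit? 0 HI _) (refl , hit)))

  signedCount-[]-miss : (HI : Subset 0 → ℤ) {τ : ℕ} → resMod m (HI Vec.[]) ≢ τ → signedCount m HI τ ≡ 0ℤ
  signedCount-[]-miss HI miss =
    cong (λ n → + n - 0ℤ) (cong length (filter-reject (parity-hit? 0 HI _) (miss ∘ proj₂)))

  signedCount-cong : ∀ {L} {HI HI′ : Subset L → ℤ} {τ τ′ : ℕ} →
    (∀ I → resMod m (HI I) ≡ τ ⇔ resMod m (HI′ I) ≡ τ′) → signedCount m HI τ ≡ signedCount m HI′ τ′
  signedCount-cong {L} {HI} {HI′} {τ} {τ′} hit⇔hit′ = cong₂ (λ e o → + e - + o) (same-count 0) (same-count 1)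
    where
    same-count : ∀ k → parityCount k HI τ ≡ parityCount k HI′ τ′
    same-count k = length-filter-⇔ (parity-hit? k HI τ) (parity-hit? k HI′ τ′)
                     (λ I → ⇔-id _ ×-⇔ hit⇔hit′ I) (allSubsets L)

  signedCount-∷ : ∀ {L} (HI : Subset (suc L) → ℤ) τ →
    signedCount m HI τ ≡ signedCount m (HI ∘ (false Vec.∷_)) τ - signedCount m (HI ∘ (true Vec.∷_)) τ
  signedCount-∷ HI τ = begin
    + evenCount m HI τ - + oddCount m HI τ
      ≡⟨ cong₂ (λ e o → + e - + o) (evenCount-∷ HI τ) (oddCount-∷ HI τ) ⟩
    + (e₀ ℕ.+ o₁) - + (o₀ ℕ.+ e₁)
      ≡⟨ cong₂ _-_ (ℤ.pos-+ e₀ o₁) (ℤ.pos-+ o₀ e₁) ⟩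
    (+ e₀ + + o₁) - (+ o₀ + + e₁)
      ≡⟨ regroup (+ e₀) (+ o₀) (+ e₁) (+ o₁) ⟩
    (+ e₀ - + o₀) - (+ e₁ - + o₁) ∎
    where
    open ≡-Reasoning
    e₀ = evenCount m (HI ∘ (false Vec.∷_)) τ
    o₀ = oddCount m (HI ∘ (false Vec.∷_)) τ
    e₁ = evenCount m (HI ∘ (true Vec.∷_)) τ
    o₁ = oddCount m (HI ∘ (true Vec.∷_)) τ
    regroup : ∀ e₀ o₀ e₁ o₁ → (e₀ + o₁) - (o₀ + e₁) ≡ (e₀ - o₀) - (e₁ - o₁)
    regroup e₀ o₀ e₁ o₁ = solve (e₀ ∷ o₀ ∷ e₁ ∷ o₁ ∷ [])

  resMod-shift-⇔ : ∀ a s t → resMod m (a + s) ≡ resMod m t ⇔ resMod m s ≡ resMod m (t - a)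
  resMod-shift-⇔ a s t = mk⇔
    (λ hit → ≡-mod⇒resMod≡ (≡-mod (subst (+ m ∣ₛ_) shift (∣-difference (resMod≡⇒≡-mod hit)))))
    (λ hit → ≡-mod⇒resMod≡ (≡-mod (subst (+ m ∣ₛ_) (sym shift) (∣-difference (resMod≡⇒≡-mod hit)))))
    where
    shift : (a + s) - t ≡ s - (t - a)
    shift = solve (a ∷ s ∷ t ∷ [])

  alternatingCount : ∀ {L} → (Fin L → ℤ) → ℤ → ℤ
  alternatingCount c t = signedCount m (subsetSum c) (resMod m t)

  alternatingCount-periodic : ∀ {L} (c : Fin L → ℤ) {y z} → y ≡ z mod m →
                              alternatingCount c y ≡ alternatingCount c z
  alternatingCount-periodic c = cong (signedCount m (subsetSum c)) ∘ ≡-mod⇒resMod≡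

  alternatingCount-∷ : ∀ {L} (c : Fin (suc L) → ℤ) t →
    alternatingCount c t ≡ alternatingCount (c ∘ suc) t - alternatingCount (c ∘ suc) (t - c zero)
  alternatingCount-∷ c t = begin
    alternatingCount c t
      ≡⟨ signedCount-∷ (subsetSum c) (resMod m t) ⟩
    signedCount m (λ I → 0ℤ + subsetSum (c ∘ suc) I) (resMod m t)
      - signedCount m (λ I → c zero + subsetSum (c ∘ suc) I) (resMod m t)
      ≡⟨ cong₂ _-_ (signedCount-cong (λ I → resMod-shift-⇔ 0ℤ (subsetSum (c ∘ suc) I) t))
                   (signedCount-cong (λ I → resMod-shift-⇔ (c zero) (subsetSum (c ∘ suc) I) t)) ⟩
    alternatingCount (c ∘ suc) (t - 0ℤ) - alternatingCount (c ∘ suc) (t - c zero)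
      ≡⟨ cong (λ u → alternatingCount (c ∘ suc) u - alternatingCount (c ∘ suc) (t - c zero))
              (ℤ.+-identityʳ t) ⟩
    alternatingCount (c ∘ suc) t - alternatingCount (c ∘ suc) (t - c zero) ∎
    where open ≡-Reasoning

  alternatingCount-[]-0 : (c : Fin 0 → ℤ) → alternatingCount c 0ℤ ≡ 1ℤ
  alternatingCount-[]-0 c = signedCount-[]-hit (subsetSum c) refl

  alternatingCount-[]-1 : m ≢ 1 → (c : Fin 0 → ℤ) → alternatingCount c 1ℤ ≡ 0ℤ
  alternatingCount-[]-1 m≢1 c =
    signedCount-[]-miss (subsetSum c) (m≢1 ∘ ℕ.∣1⇒≡1 ∘ ∣⇒∣ᵤ ∘ ∣-difference ∘ resMod≡⇒≡-mod)

  alternatingCount-nonconstant : ∀ {d} → d ≢ 1 → Coprime d m → m ≢ 1 →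
    ∀ {L} (c : Fin L → ℤ) → (∀ i → UnitMod m (c i)) →
    ¬ (∀ t → alternatingCount c t ≡ alternatingCount c 0ℤ mod d)
  alternatingCount-nonconstant {d} d≢1 _ m≢1 {zero} c _ constant =
    d≢1 (ℕ.∣1⇒≡1 (∣⇒∣ᵤ (∣-difference
      (subst₂ (_≡_mod d) (alternatingCount-[]-1 m≢1 c) (alternatingCount-[]-0 c) (constant 1ℤ)))))
  alternatingCount-nonconstant {d} d≢1 d⊥m m≢1 {suc L} c units constant =
    alternatingCount-nonconstant d≢1 d⊥m m≢1 (c ∘ suc) (units ∘ suc)
      (constant-under-unit-drift G (alternatingCount-periodic (c ∘ suc)) d⊥m (units zero) drift)
    where
    G = alternatingCount (c ∘ suc)
    a = c zero
    split : ∀ x y → x ≡ (x - y) + y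
    split x y = solve (x ∷ y ∷ [])
    undo : ∀ t a → (t + a) - a ≡ t
    undo t a = solve (t ∷ a ∷ [])
    drift : ∀ t → G (t + a) ≡ G t + alternatingCount c 0ℤ mod d
    drift t = begin
      G (t + a)                              ≡⟨ split (G (t + a)) (G t) ⟩
      (G (t + a) - G t) + G t                ≡⟨ cong (λ u → (G (t + a) - G u) + G t) (undo t a) ⟨
      (G (t + a) - G ((t + a) - a)) + G t    ≡⟨ cong (_+ G t) (alternatingCount-∷ c (t + a)) ⟨
      alternatingCount c (t + a) + G t       ≈⟨ +-congʳ-mod (G t) (constant (t + a)) ⟩
      alternatingCount c 0ℤ + G t            ≡⟨ ℤ.+-comm _ (G t) ⟩
      G t + alternatingCount c 0ℤ            ∎
      where open ≡-mod-Reasoning d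

balanced⇒signedCount≡0 : ∀ {L m d} .{{_ : NonZero m}} .{{_ : NonZero d}} (HI : Subset L → ℤ) →
  (∀ I → evenCount m HI (resMod m (HI I)) % d ≡ oddCount m HI (resMod m (HI I)) % d) →
  ∀ τ → signedCount m HI τ ≡ 0ℤ mod d
balanced⇒signedCount≡0 {L} {m} {d} HI balanced τ
  with Any.any? (λ I → resMod m (HI I) ≟ τ) (allSubsets L)
... | yes attained = attained⇒≡0 (Any.satisfied attained)
  where
  attained⇒≡0 : ∃[ I ] resMod m (HI I) ≡ τ → signedCount m HI τ ≡ 0ℤ mod d
  attained⇒≡0 (I , refl) =
    x≡y⇒x-y≡0-mod (resMod≡⇒≡-mod (trans (resMod-pos d _) (trans (balanced I) (sym (resMod-pos d _)))))
... | no unattained =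
  subst (_≡ 0ℤ mod d) (sym (cong₂ (λ e o → + e - + o) (no-hits 0) (no-hits 1))) ≡-mod-refl
  where
  no-hits : ∀ k → parityCount {m = m} k HI τ ≡ 0
  no-hits k =
    cong length (filter-none (parity-hit? k HI τ) (All.map (_∘ proj₂) (¬Any⇒All¬ _ unattained)))

lemma5p1 : (L : ℕ) → 1 ≤ L →
  (Q : Fin (suc L) → ℕ) → (∀ i → 0 < Q i) →
  (∀ i j → i ≢ j → Coprime (Q i) (Q j)) →
  (p ν : ℕ) → Prime p → 3 < p → 1 ≤ ν →
  (p ^ ν) ∣ Q zero → ¬ ((p ^ suc ν) ∣ Q zero) →
  .{{_ : NonZero (p ^ ν)}} →
  (h : Fin L → ℤ) →
  (∀ (I : Subset L) →
    evenCount (p ^ ν) (H Q h) (resMod (p ^ ν) (H Q h I)) % 3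
      ≡ oddCount (p ^ ν) (H Q h) (resMod (p ^ ν) (H Q h I)) % 3) →
  ∃ λ (i : Fin L) → (+ p) ℤD.∣ h i
lemma5p1 _ _ _ _ _ _ zero _ _ () _ _ _ _
lemma5p1 L _ Q _ Q-coprime p (suc ν) p-prime 3<p _ pᵛ∣Q₀ _ h balanced
  with any? (λ i → p ℕ.∣? ∣ h i ∣)
... | yes p∣hᵢ = p∣hᵢ
... | no p∤h = contradiction constant (alternatingCount-nonconstant (λ ()) 3⊥m m≢1 c units)
  where
  m = p ^ suc ν
  c : Fin L → ℤ
  c i = + Q (suc i) * h i
  vanishes : ∀ t → alternatingCount {m = m} c t ≡ 0ℤ mod 3
  vanishes t = balanced⇒signedCount≡0 (H Q h) balanced (resMod m t)
  constant : ∀ t → alternatingCount {m = m} c t ≡ alternatingCount c 0ℤ mod 3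
  constant t = ≡-mod-trans (vanishes t) (≡-mod-sym (vanishes 0ℤ))
  3⊥m : Coprime 3 m
  3⊥m = coprime-^ (suc ν) (Coprime.sym (prime⇒coprime p-prime 3<p))
  p≢1 : p ≢ 1
  p≢1 refl = contradiction 3<p λ { (ℕ.s≤s ()) }
  m≢1 : m ≢ 1
  m≢1 m≡1 = [ (λ ()) , p≢1 ]′ (ℕ.m^n≡1⇒n≡0∨m≡1 p (suc ν) m≡1)
  p∣Q₀ : p ∣ Q zero
  p∣Q₀ = ℕ.∣-trans (ℕ.m∣m*n (p ^ ν)) pᵛ∣Q₀
  p∤c : ∀ i → ¬ p ∣ ∣ c i ∣
  p∤c i p∣c = [ (λ p∣Qᵢ → p≢1 (Q-coprime zero (suc i) (λ ()) (p∣Q₀ , p∣Qᵢ)))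
              , (λ p∣hᵢ → p∤h (i , p∣hᵢ)) ]
    (euclidsLemma (Q (suc i)) ∣ h i ∣ p-prime (subst (p ∣_) (ℤ.abs-* (+ Q (suc i)) (h i)) p∣c))
  units : ∀ i → UnitMod m (c i)
  units i = coprime⇒unitMod (c i) (coprime-^ (suc ν) (∤⇒coprime p-prime (p∤c i)))
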